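{- Let $d\geq 3$ and $n,k$ be positive integers with $k\leq n$ and $k\leq\frac{n^{d/(d+1)}}{\sqrt[d+1]{d\log_2(n+1)}}$. Then there exist $A,A',B,B'\in\{0,1\}^{n^{\times d}}$ with $A\neq A'$ but $S_k(A)=S_k(A')$, and $B\neq B'$ but $S_k^{\mathrm p}(B)=S_k^{\mathrm p}(B')$.
   Context: $\{0,1\}^{n^{\times d}}$ denotes the set of binary arrays indexed by $[n]^d$, $[n]=\{1,\ldots,n\}$. For $1\leq k\leq n$, a $k^{\times d}$-subhypermatrix of $A$ is obtained by choosing $k$-subsets $T_1,\ldots,T_d\subseteq[n]$ and keeping the entries indexed by $T_1\times\cdots\times T_d$, re-indexed order-preservingly by $[k]^d$; it is principal if $T_1=\cdots=T_d$. $S_k(A)$ is the entrywise sum of all $\binom nk^d$ $k^{\times d}$-subhypermatrices of $A$, and $S_k^{\mathrm p}(A)$ is the entrywise sum of all $\binom nk$ principal ones. -}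

module Defs where

open import Data.Nat using (ℕ; zero; suc)
open import Data.Fin using (Fin; zero; suc)
open import Data.Bool using (Bool; true; false)
open import Data.List using (List; []; _∷_; map; _++_; concatMap)
open import Data.Nat.ListAction using (sum)

HMat : ℕ → ℕ → Set
HMat n d = (Fin d → Fin n) → Bool

NMat : ℕ → ℕ → Set
NMat k d = (Fin d → Fin k) → ℕ

cons : ∀ {A : Set} {m : ℕ} → A → (Fin m → A) → Fin (suc m) → A
cons x f zero = x
cons x f (suc i) = f i

-- all strictly increasing maps Fin k → Fin n, each exactly once;
-- these are the k-subsets T ⊆ [n] together with their order-preserving
-- re-indexing by [k]
choose : (k n : ℕ) → List (Fin k → Fin n)
choose zero n = (λ ()) ∷ []
choose (suc k) zero = []
choose (suc k) (suc n) =
  map (λ f i → suc (f i)) (choose (suc k) n)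
  ++ map (λ f → cons zero (λ i → suc (f i))) (choose k n)

tuples : ∀ {X : Set} (d : ℕ) → List X → List (Fin d → X)
tuples zero xs = (λ ()) ∷ []
tuples (suc d) xs = concatMap (λ x → map (cons x) (tuples d xs)) xs

bit : Bool → ℕ
bit true = 1
bit false = 0

-- S_k(A): entrywise sum of all (n choose k)^d subhypermatrices of shape k^{×d}
S : ∀ {n d} (k : ℕ) → HMat n d → NMat k d
S {n} {d} k A j =
  sum (map (λ T → bit (A (λ i → T i (j i)))) (tuples d (choose k n)))

-- S_k^p(A): entrywise sum of all (n choose k) principal subhypermatrices
Sp : ∀ {n d} (k : ℕ) → HMat n d → NMat k d
Sp {n} {d} k A j =
  sum (map (λ T → bit (A (λ i → T (j i)))) (choose k n))

-- Pigeonhole: there are 2^(n^d) binary hypermatrices, but S_k(A) and S_k^p(A) are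
-- k^(×d) arrays with entries at most n^(kd) (each entry counts at most binom(n,k)^d ≤ n^(kd)
-- ones), so each takes fewer than (1 + n^(kd))^(k^d) < (n+1)^(d k^(d+1)) ≤ 2^(n^d) values.
module Submission where

open import Data.Nat using (ℕ; _≤_; _^_; _*_; suc)
open import Data.Product using (Σ; _×_)
open import Relation.Binary.PropositionalEquality using (_≡_)
open import Relation.Nullary using (¬_)
open import Defs

open import Data.Bool using (Bool; true; false)
open import Data.Fin using (Fin; toℕ; fromℕ<; finToFun; funToFin; combine)
open import Data.Fin.Properties
  using (2↔Bool; pigeonhole; <⇒≢; toℕ-fromℕ<; funToFin-finToFin; finToFun-funToFin)
open import Data.List using (List; []; _∷_; map; _++_; concatMap; length)
open import Data.List.Properties using (map-cong; length-map; length-++)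
open import Data.Nat using (zero; _+_; _<_; z≤n; s≤s; NonZero; >-nonZero)
open import Data.Nat.ListAction using (sum)
open import Data.Nat.Properties hiding (<⇒≢)
open import Data.Product using (_,_)
open import Function using (_∘_; Injection)
open import Function.Properties.Inverse using (↔⇒↣)
open import Relation.Binary.PropositionalEquality
  using (refl; sym; trans; cong; cong₂; _≗_; module ≡-Reasoning)

Collision : ∀ {n d k} → (HMat n d → NMat k d) → Set
Collision {n} {d} f = Σ (HMat n d) (λ A → Σ (HMat n d) (λ A' →
  (¬ (∀ x → A x ≡ A' x)) × (∀ j → f A j ≡ f A' j)))

-- Indices are functions, so without function extensionality a hypermatrix may
-- distinguish pointwise equal indices; those built by decoding below do not.
IndexExtensional : ∀ {n d} → HMat n d → Set
IndexExtensional {n} {d} A = ∀ {x y : Fin d → Fin n} → x ≗ y → A x ≡ A y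

funToFin-cong : ∀ {m n} {f g : Fin m → Fin n} → f ≗ g → funToFin f ≡ funToFin g
funToFin-cong {zero}  f≗g = refl
funToFin-cong {suc m} f≗g = cong₂ combine (f≗g Fin.zero) (funToFin-cong (f≗g ∘ Fin.suc))

module _ {n d : ℕ} where

  open Injection (↔⇒↣ 2↔Bool) using (to; injective)

  decode : Fin (2 ^ (n ^ d)) → HMat n d
  decode i x = to (finToFun {2} {n ^ d} i (funToFin x))

  decode-extensional : ∀ i → IndexExtensional (decode i)
  decode-extensional i x≗y = cong (to ∘ finToFun {2} {n ^ d} i) (funToFin-cong x≗y)

  decode-injective : ∀ {i j} → (∀ x → decode i x ≡ decode j x) → i ≡ j
  decode-injective {i} {j} eq = begin
    i                                  ≡⟨ funToFin-finToFin {n ^ d} {2} i ⟨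
    funToFin (finToFun {2} {n ^ d} i)  ≡⟨ funToFin-cong bits ⟩
    funToFin (finToFun {2} {n ^ d} j)  ≡⟨ funToFin-finToFin {n ^ d} {2} j ⟩
    j                                  ∎
    where
    open ≡-Reasoning
    bits : finToFun {2} {n ^ d} i ≗ finToFun j
    bits t = injective (trans (cong (to ∘ finToFun i) (sym (funToFin-finToFin {d} {n} t)))
               (trans (eq (finToFun t)) (cong (to ∘ finToFun j) (funToFin-finToFin {d} {n} t))))

module _ {n d k M : ℕ} (f : HMat n d → NMat k d) (f<M : ∀ A j → f A j < M) where

  encode : HMat n d → Fin (M ^ (k ^ d))
  encode A = funToFin {k ^ d} {M} (λ p → fromℕ< (f<M A (finToFun {k} {d} p)))

  encode-injective : ∀ {A A'} → encode A ≡ encode A' → ∀ p → f A (finToFun p) ≡ f A' (finToFun p)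
  encode-injective {A} {A'} same-code p = begin
    f A (finToFun p)                       ≡⟨ toℕ-fromℕ< _ ⟨
    toℕ (fromℕ< (f<M A (finToFun p)))      ≡⟨ cong toℕ (finToFun-funToFin _ p) ⟨
    toℕ (finToFun (encode A) p)            ≡⟨ cong (λ c → toℕ (finToFun c p)) same-code ⟩
    toℕ (finToFun (encode A') p)           ≡⟨ cong toℕ (finToFun-funToFin _ p) ⟩
    toℕ (fromℕ< (f<M A' (finToFun p)))     ≡⟨ toℕ-fromℕ< _ ⟩
    f A' (finToFun p)                      ∎
    where open ≡-Reasoning

  collision : (∀ A → IndexExtensional A → ∀ {j j'} → j ≗ j' → f A j ≡ f A j') →
    M ^ (k ^ d) < 2 ^ (n ^ d) → Collision f
  collision f-cong M^k^d<2^n^d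
    with i , j , i<j , same-code ← pigeonhole M^k^d<2^n^d (encode ∘ decode)
    = decode i , decode j , <⇒≢ i<j ∘ decode-injective , same-value
    where
    same-value : ∀ x → f (decode i) x ≡ f (decode j) x
    same-value x = begin
      f (decode i) x                        ≡⟨ f-cong (decode i) (decode-extensional i) round-trip ⟨
      f (decode i) (finToFun (funToFin x))  ≡⟨ encode-injective same-code (funToFin x) ⟩
      f (decode j) (finToFun (funToFin x))  ≡⟨ f-cong (decode j) (decode-extensional j) round-trip ⟩
      f (decode j) x                        ∎
      where
      open ≡-Reasoning
      round-trip : finToFun {k} {d} (funToFin x) ≗ x
      round-trip = finToFun-funToFin x

sum-map-bit≤length : ∀ {X : Set} (h : X → Bool) (L : List X) → sum (map (bit ∘ h) L) ≤ length L
sum-map-bit≤length h [] = z≤n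
sum-map-bit≤length h (x ∷ L) with h x
... | true  = s≤s (sum-map-bit≤length h L)
... | false = m≤n⇒m≤1+n (sum-map-bit≤length h L)

length-concatMap-map : ∀ {X Y Z : Set} (g : X → Y → Z) (xs : List X) (ys : List Y) →
  length (concatMap (λ x → map (g x) ys) xs) ≡ length xs * length ys
length-concatMap-map g [] ys = refl
length-concatMap-map g (x ∷ xs) ys =
  trans (length-++ (map (g x) ys))
        (cong₂ _+_ (length-map (g x) ys) (length-concatMap-map g xs ys))

length-tuples : ∀ {X : Set} d (L : List X) → length (tuples d L) ≡ length L ^ d
length-tuples zero    L = refl
length-tuples (suc d) L =
  trans (length-concatMap-map cons L (tuples d L)) (cong (length L *_) (length-tuples d L))

length-choose≤ : ∀ k n → length (choose k n) ≤ n ^ k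
length-choose≤ zero    n       = ≤-refl
length-choose≤ (suc k) zero    = z≤n
length-choose≤ (suc k) (suc n) = begin
  length (map _ (choose (suc k) n) ++ map _ (choose k n))
    ≡⟨ length-++ (map _ (choose (suc k) n)) ⟩
  length (map _ (choose (suc k) n)) + length (map _ (choose k n))
    ≡⟨ cong₂ _+_ (length-map _ (choose (suc k) n)) (length-map _ (choose k n)) ⟩
  length (choose (suc k) n) + length (choose k n)
    ≤⟨ +-mono-≤ (length-choose≤ (suc k) n) (length-choose≤ k n) ⟩
  n * n ^ k + n ^ k
    ≤⟨ +-mono-≤ (*-monoʳ-≤ n (^-monoˡ-≤ k (n≤1+n n))) (^-monoˡ-≤ k (n≤1+n n)) ⟩
  n * suc n ^ k + suc n ^ k
    ≡⟨ +-comm (n * suc n ^ k) _ ⟩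
  suc n ^ suc k ∎
  where open ≤-Reasoning

module _ {n d : ℕ} (k : ℕ) where

  S≤ : ∀ A j → S {n} {d} k A j ≤ n ^ (k * d)
  S≤ A j = begin
    S k A j                         ≤⟨ sum-map-bit≤length (λ T → A (λ i → T i (j i))) (tuples d (choose k n)) ⟩
    length (tuples d (choose k n))  ≡⟨ length-tuples d (choose k n) ⟩
    length (choose k n) ^ d         ≤⟨ ^-monoˡ-≤ d (length-choose≤ k n) ⟩
    (n ^ k) ^ d                     ≡⟨ ^-*-assoc n k d ⟩
    n ^ (k * d)                     ∎
    where open ≤-Reasoning

  Sp≤ : ∀ A j → Sp {n} {d} k A j ≤ n ^ k
  Sp≤ A j = ≤-trans (sum-map-bit≤length (λ T → A (λ i → T (j i))) (choose k n)) (length-choose≤ k n)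

  S-cong : ∀ A → IndexExtensional A → ∀ {j j'} → j ≗ j' → S {n} {d} k A j ≡ S k A j'
  S-cong A A-ext j≗j' =
    cong sum (map-cong (λ T → cong bit (A-ext (λ i → cong (T i) (j≗j' i)))) (tuples d (choose k n)))

  Sp-cong : ∀ A → IndexExtensional A → ∀ {j j'} → j ≗ j' → Sp {n} {d} k A j ≡ Sp k A j'
  Sp-cong A A-ext j≗j' =
    cong sum (map-cong (λ T → cong bit (A-ext (λ i → cong T (j≗j' i)))) (choose k n))

1+n^e<[1+n]^e : ∀ n e → 1 ≤ n → 2 ≤ e → suc (n ^ e) < suc n ^ e
1+n^e<[1+n]^e n (suc zero)    _   (s≤s ())
1+n^e<[1+n]^e n (suc (suc e)) 1≤n _ = begin-strict
  suc (n ^ suc (suc e))              <⟨ ≤-refl ⟩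
  2 + n * n ^ suc e                  ≤⟨ +-mono-≤ 2≤[1+n]^[1+e] (*-monoʳ-≤ n (^-monoˡ-≤ (suc e) (n≤1+n n))) ⟩
  suc n ^ suc e + n * suc n ^ suc e  ≡⟨⟩
  suc n ^ suc (suc e)                ∎
  where
  open ≤-Reasoning
  2≤[1+n]^[1+e] : 2 ≤ suc n ^ suc e
  2≤[1+n]^[1+e] = ≤-trans (s≤s 1≤n) (m≤m*n (suc n) (suc n ^ e) {{m^n≢0 (suc n) e}})

[1+n^kd]^k^d<2^n^d : ∀ n d k .{{_ : NonZero k}} → 1 ≤ n → 2 ≤ k * d →
  suc n ^ (d * k ^ suc d) ≤ 2 ^ (n ^ d) → suc (n ^ (k * d)) ^ (k ^ d) < 2 ^ (n ^ d)
[1+n^kd]^k^d<2^n^d n d k 1≤n 2≤kd hyp = begin-strict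
  suc (n ^ (k * d)) ^ (k ^ d)  <⟨ ^-monoˡ-< (k ^ d) {{>-nonZero (m^n>0 k d)}} (1+n^e<[1+n]^e n (k * d) 1≤n 2≤kd) ⟩
  (suc n ^ (k * d)) ^ (k ^ d)  ≡⟨ ^-*-assoc (suc n) (k * d) (k ^ d) ⟩
  suc n ^ (k * d * k ^ d)      ≡⟨ cong (suc n ^_) (trans (cong (_* k ^ d) (*-comm k d)) (*-assoc d k (k ^ d))) ⟩
  suc n ^ (d * k ^ suc d)      ≤⟨ hyp ⟩
  2 ^ (n ^ d)                  ∎
  where open ≤-Reasoning

lemma1 : (d n k : ℕ) → 3 ≤ d → 1 ≤ k → k ≤ n →
    suc n ^ (d * k ^ suc d) ≤ 2 ^ (n ^ d) →
    Σ (HMat n d) (λ A → Σ (HMat n d) (λ A' →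
      (¬ (∀ x → A x ≡ A' x)) × (∀ j → S k A j ≡ S k A' j)))
    × Σ (HMat n d) (λ B → Σ (HMat n d) (λ B' →
      (¬ (∀ x → B x ≡ B' x)) × (∀ j → Sp k B j ≡ Sp k B' j)))
lemma1 d@(suc _) n k@(suc _) 3≤d 1≤k k≤n hyp =
    collision (S k) (λ A j → s≤s (S≤ k A j)) (S-cong k) count<
  , collision (Sp k) (λ A j → s≤s (≤-trans (Sp≤ k A j) n^k≤n^kd)) (Sp-cong k) count<
  where
  1≤n : 1 ≤ n
  1≤n = ≤-trans 1≤k k≤n
  count< : suc (n ^ (k * d)) ^ (k ^ d) < 2 ^ (n ^ d)
  count< = [1+n^kd]^k^d<2^n^d n d k 1≤n (≤-trans (≤-trans (s≤s (s≤s z≤n)) 3≤d) (m≤n*m d k)) hyp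
  n^k≤n^kd : n ^ k ≤ n ^ (k * d)
  n^k≤n^kd = ^-monoʳ-≤ n {{>-nonZero 1≤n}} (m≤m*n k d)
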